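{- Let $G$ be a connected graph (with at least two vertices) with $Tr_t(G)=k\geq 2$. Then there exists a total transitive partition $\pi=\{V_1,V_2,\dots,V_k\}$ of $G$ of size $k$ such that $|V_k|=2$.
   Context: A total transitive partition of order $k$ of $G=(V,E)$ is a partition $\{V_1,\dots,V_k\}$ of $V$ into nonempty sets such that for all $1\leq i\leq j\leq k$, every vertex of $V_j$ has a neighbour in $V_i$ (for $i=j$: every vertex of $V_i$ is adjacent to another vertex of $V_i$). $Tr_t(G)$ is the maximum order of such a partition. -}

module Defs where

open import Level using (0ℓ)
open import Data.Nat using (ℕ; suc; _≤_; _<_; _+_)
open import Data.Fin using (Fin; toℕ; _≟_)
open import Data.List using (List; length; filter; allFin)
open import Data.Product using (Σ; ∃; _×_; _,_)
open import Relation.Binary.PropositionalEquality using (_≡_; _≢_)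
open import Relation.Binary.Definitions using (Symmetric)
import Data.Empty

record Graph (n : ℕ) : Set₁ where
  field
    Adj   : Fin n → Fin n → Set
    sym   : Symmetric Adj
    irrefl : ∀ {u} → Adj u u → Data.Empty.⊥
open Graph public

data Walk {n : ℕ} (G : Graph n) : Fin n → Fin n → Set where
  here : ∀ {u} → Walk G u u
  step : ∀ {u v w} → Adj G u v → Walk G v w → Walk G u w

Connected : ∀ {n} → Graph n → Set
Connected G = ∀ u v → Walk G u v

-- A partition of V into k classes V_1..V_k is encoded by a map
-- c : Fin n → Fin k (class index i : Fin k stands for V_{toℕ i + 1}),
-- with every class nonempty.
Nonempty : ∀ {n k} → (Fin n → Fin k) → Set
Nonempty {n} c = ∀ i → ∃ λ v → c v ≡ i

TotalTransitive : ∀ {n k} → Graph n → (Fin n → Fin k) → Set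
TotalTransitive G c =
  ∀ i j → toℕ i ≤ toℕ j → ∀ v → c v ≡ j → ∃ λ u → Adj G v u × c u ≡ i

IsTTP : ∀ {n} → Graph n → (k : ℕ) → (Fin n → Fin k) → Set
IsTTP G k c = Nonempty c × TotalTransitive G c

HasTTP : ∀ {n} → Graph n → ℕ → Set
HasTTP {n} G k = Σ (Fin n → Fin k) (IsTTP G k)

TrT≡ : ∀ {n} → Graph n → ℕ → Set
TrT≡ G k = HasTTP G k × (∀ m → HasTTP G m → m ≤ k)

classSize : ∀ {n k} → (Fin n → Fin k) → Fin k → ℕ
classSize {n} c i = length (filter (λ v → c v ≟ i) (allFin n))

{-# OPTIONS --safe #-}
module Submission where

-- Take any total transitive partition of order k ≥ 2, a vertex a of V_k and
-- a neighbour b of a in V_k, and move every other vertex of V_k into V_1.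
-- A moved vertex already had a neighbour in V_1, and V_1 only grows, so it
-- stays valid; the classes V_2 … V_{k-1} are untouched; and the only vertices
-- needing a neighbour in the new V_k = {a, b} are a and b themselves.

open import Defs
open import Level using (0ℓ)
open import Data.Nat using (ℕ; suc; _+_; _≤_; z≤n; s≤s)
open import Data.Nat.Properties using (+-suc; +-comm; ≤-refl; ≤-trans)
open import Data.Fin using (Fin; zero; toℕ; fromℕ; _≟_)
open import Data.Fin.Properties using (≤fromℕ; ≤-antisym; toℕ-fromℕ)
open import Data.List using ([]; _∷_; length; filter; allFin)
open import Data.List.Properties using (filter-≐)
open import Data.List.Membership.Propositional using (_∈_)
open import Data.List.Membership.Propositional.Properties using (∈-filter⁺; ∈-allFin)
open import Data.List.Relation.Unary.All using (All; _∷_)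
open import Data.List.Relation.Unary.All.Properties using (all-filter)
open import Data.List.Relation.Unary.AllPairs using (_∷_)
open import Data.List.Relation.Unary.Unique.Propositional using (Unique)
open import Data.List.Relation.Unary.Unique.Propositional.Properties using (allFin⁺; filter⁺)
open import Data.Product using (Σ; ∃; _×_; _,_)
open import Data.Sum using (inj₁; inj₂)
open import Data.Empty using (⊥-elim)
open import Relation.Nullary using (¬_; yes; no; contradiction; ¬?; _×-dec_)
open import Relation.Nullary.Decidable using (decidable-stable)
open import Relation.Unary using (Pred; Decidable; _∪_)
open import Relation.Unary.Properties using (_∪?_)
open import Relation.Binary.Definitions using (DecidableEquality)
open import Relation.Binary.PropositionalEquality as ≡ using (_≡_; _≢_; refl; trans; cong; cong₂)
open ≡.≡-Reasoning

module _ {A : Set} where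

  Unique-constant⇒length≡1 : ∀ {x : A} {xs} → Unique xs → x ∈ xs → All (_≡ x) xs → length xs ≡ 1
  Unique-constant⇒length≡1 {xs = _ ∷ []}    _                 _ _                 = refl
  Unique-constant⇒length≡1 {xs = _ ∷ _ ∷ _} ((y≢z ∷ _) ∷ _) _ (refl ∷ refl ∷ _) = ⊥-elim (y≢z refl)

  count-≡-Unique : (_≟ᴬ_ : DecidableEquality A) → ∀ {x xs} → Unique xs → x ∈ xs →
                   length (filter (_≟ᴬ x) xs) ≡ 1
  count-≡-Unique _≟ᴬ_ {x} {xs} xs! x∈xs = Unique-constant⇒length≡1
    (filter⁺ (_≟ᴬ x) xs!) (∈-filter⁺ (_≟ᴬ x) x∈xs refl) (all-filter (_≟ᴬ x) xs)

  count-∪ : {P Q : Pred A 0ℓ} (P? : Decidable P) (Q? : Decidable Q) → (∀ {x} → P x → ¬ Q x) →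
            ∀ xs → length (filter (P? ∪? Q?) xs) ≡ length (filter P? xs) + length (filter Q? xs)
  count-∪ P? Q? P⊥Q []       = refl
  count-∪ P? Q? P⊥Q (x ∷ xs) with P? x | Q? x
  ... | yes p | yes q = contradiction q (P⊥Q p)
  ... | yes _ | no _  = cong suc (count-∪ P? Q? P⊥Q xs)
  ... | no _  | yes _ = trans (cong suc (count-∪ P? Q? P⊥Q xs)) (≡.sym (+-suc _ _))
  ... | no _  | no _  = count-∪ P? Q? P⊥Q xs

count-allFin-≡ : ∀ {n} (a : Fin n) → length (filter (_≟ a) (allFin n)) ≡ 1
count-allFin-≡ {n} a = count-≡-Unique _≟_ (allFin⁺ n) (∈-allFin a)

toℕ-fromℕ+1 : ∀ k → toℕ (fromℕ k) + 1 ≡ suc k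
toℕ-fromℕ+1 k = trans (+-comm _ 1) (cong suc (toℕ-fromℕ k))

module Collapse {n m} (G : Graph n) (c : Fin n → Fin (suc (suc m))) {a b : Fin n}
                (a~b : Adj G a b) (ca : c a ≡ fromℕ (suc m)) (cb : c b ≡ fromℕ (suc m)) where

  last : Fin (suc (suc m))
  last = fromℕ (suc m)

  Pinned : Pred (Fin n) 0ℓ
  Pinned = (_≡ a) ∪ (_≡ b)

  pinned? : Decidable Pinned
  pinned? = (_≟ a) ∪? (_≟ b)

  Dropped : Pred (Fin n) 0ℓ
  Dropped v = c v ≡ last × ¬ Pinned v

  dropped? : Decidable Dropped
  dropped? v = (c v ≟ last) ×-dec ¬? (pinned? v)

  collapse : Fin n → Fin (suc (suc m))
  collapse v with dropped? v
  ... | yes _ = zero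
  ... | no _  = c v

  collapse-≤ : ∀ v → toℕ (collapse v) ≤ toℕ (c v)
  collapse-≤ v with dropped? v
  ... | yes _ = z≤n
  ... | no _  = ≤-refl

  collapse-kept : ∀ {v} → ¬ Dropped v → collapse v ≡ c v
  collapse-kept {v} ¬d with dropped? v
  ... | yes d = contradiction d ¬d
  ... | no _  = refl

  collapse-pinned : ∀ {v} → Pinned v → collapse v ≡ last
  collapse-pinned (inj₁ refl) = trans (collapse-kept (λ (_ , ¬p) → ¬p (inj₁ refl))) ca
  collapse-pinned (inj₂ refl) = trans (collapse-kept (λ (_ , ¬p) → ¬p (inj₂ refl))) cb

  collapse-last⇒pinned : ∀ {v} → collapse v ≡ last → Pinned v
  collapse-last⇒pinned {v} eq with dropped? v
  ... | yes _ = contradiction eq λ ()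
  ... | no ¬d = decidable-stable (pinned? v) λ ¬p → ¬d (eq , ¬p)

  collapse-class : ∀ {v i} → c v ≡ i → i ≢ last → collapse v ≡ i
  collapse-class cv≡i i≢last =
    trans (collapse-kept λ (cv≡last , _) → i≢last (trans (≡.sym cv≡i) cv≡last)) cv≡i

  pinned-partner : ∀ {v} → Pinned v → ∃ λ u → Adj G v u × collapse u ≡ last
  pinned-partner (inj₁ refl) = b , a~b , collapse-pinned (inj₂ refl)
  pinned-partner (inj₂ refl) = a , sym G a~b , collapse-pinned (inj₁ refl)

  collapse-nonempty : Nonempty c → Nonempty collapse
  collapse-nonempty ne i with i ≟ last
  ... | yes refl = a , collapse-pinned (inj₁ refl)
  ... | no i≢last = let (w , cw≡i) = ne i in w , collapse-class cw≡i i≢last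

  collapse-totalTransitive : TotalTransitive G c → TotalTransitive G collapse
  collapse-totalTransitive tt i _ i≤j v refl with i ≟ last
  ... | yes refl = pinned-partner (collapse-last⇒pinned (≤-antisym (≤fromℕ _) i≤j))
  ... | no i≢last =
    let (u , v~u , cu≡i) = tt i (c v) (≤-trans i≤j (collapse-≤ v)) v refl
    in u , v~u , collapse-class cu≡i i≢last

  collapse-isTTP : IsTTP G _ c → IsTTP G _ collapse
  collapse-isTTP (ne , tt) = collapse-nonempty ne , collapse-totalTransitive tt

  a≢b : a ≢ b
  a≢b refl = irrefl G a~b

  collapse-lastClassSize : classSize collapse last ≡ 2
  collapse-lastClassSize = begin
    length (filter (λ v → collapse v ≟ last) (allFin n))
      ≡⟨ cong length (filter-≐ _ pinned? (collapse-last⇒pinned , collapse-pinned) (allFin n)) ⟩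
    length (filter pinned? (allFin n))
      ≡⟨ count-∪ (_≟ a) (_≟ b) (λ { refl refl → a≢b refl }) (allFin n) ⟩
    length (filter (_≟ a) (allFin n)) + length (filter (_≟ b) (allFin n))
      ≡⟨ cong₂ _+_ (count-allFin-≡ a) (count-allFin-≡ b) ⟩
    2 ∎

proposition8 : (n : ℕ) → (G : Graph n) → 2 ≤ n → Connected G →
    (k : ℕ) → 2 ≤ k → TrT≡ G k →
    Σ (Fin n → Fin k) λ c → IsTTP G k c ×
      Σ (Fin k) λ i → (toℕ i + 1 ≡ k) × (classSize c i ≡ 2)
proposition8 _ _ _ _ 0 () _
proposition8 _ _ _ _ 1 (s≤s ()) _
proposition8 _ G _ _ (suc (suc m)) _ ((c , ne , tt) , _) =
  let (a , ca) = ne (fromℕ (suc m))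
      (b , a~b , cb) = tt _ _ ≤-refl a ca
      open Collapse G c a~b ca cb
  in collapse , collapse-isTTP (ne , tt) , last , toℕ-fromℕ+1 (suc m) , collapse-lastClassSize
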